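{- Let $q$ be a prime power and $m\ge1$, $\ell\ge0$ integers, and put $m_\ell=m/\gcd(m,\ell)$. Then $S_\ell$ is a multiplicative subgroup of $\mathbb F_{q^m}^*$, and: (a) if $q$ is even, then $S_\ell=\mathbb F_{q^m}^*$ when $m_\ell$ is odd, and $S_\ell=S_{\gcd(m,\ell)}$ when $m_\ell$ is even; (b) if $q$ is odd, then $S_\ell=S_0$ when $m_\ell$ is odd, and $S_\ell=S_{\gcd(m,\ell)}$ when $m_\ell$ is even. Moreover, if $m_\ell$ is odd then $|S_\ell|=q^m-1$ for $q$ even and $|S_\ell|=|S_0|=\frac{q^m-1}2$ for $q$ odd; and if $m_\ell$ is even then $|S_\ell|=|S_{\gcd(m,\ell)}|=\frac{q^m-1}{q^{\gcd(m,\ell)}+1}$.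
   Context: For a prime power $q$ and integers $m\ge1$, $j\ge0$, $S_j=S_{q,m}(j)=\{x^{q^j+1}: x\in\mathbb F_{q^m}^*\}$ (so $S_0$ is the set of nonzero squares). Here $\gcd(m,0)=m$. -}

module Defs where

open import Level using (Level; _⊔_)
open import Data.Nat using (ℕ; zero; suc; _+_; _^_; _/_; ≢-nonZero)
open import Data.Nat.GCD using (gcd; gcd[m,n]≢0)
open import Data.Nat.Primality using (Prime)
open import Data.Fin using (Fin)
open import Data.Product using (Σ; ∃; _×_)
open import Data.Sum using (inj₁)
open import Relation.Nullary using (¬_)
open import Relation.Binary.PropositionalEquality using (_≡_)
open import Algebra.Bundles using (CommutativeRing)

IsPrimePower : ℕ → Set
IsPrimePower q = Σ ℕ λ p → Σ ℕ λ k → Prime p × (q ≡ p ^ suc k)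

-- m_ℓ = m / gcd(m, ℓ)  (only meaningful for m ≥ 1; value 0 for m = 0)
mSub : ℕ → ℕ → ℕ
mSub zero    ℓ = 0
mSub (suc k) ℓ = _/_ (suc k) (gcd (suc k) ℓ)
  {{≢-nonZero (gcd[m,n]≢0 (suc k) ℓ (inj₁ λ ()))}}

module _ {c r} (R : CommutativeRing c r) where
  open CommutativeRing R using (Carrier; _≈_; _*_; 0#; 1#)

  pow : Carrier → ℕ → Carrier
  pow x zero    = 1#
  pow x (suc n) = x * pow x n

  record IsFiniteFieldOfSize (N : ℕ) : Set (c ⊔ r) where
    field
      1≉0      : ¬ (1# ≈ 0#)
      inverse  : ∀ x → ¬ (x ≈ 0#) → ∃ λ y → x * y ≈ 1#
      enum     : Fin N → Carrier
      enum-inj : ∀ i j → enum i ≈ enum j → i ≡ j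
      index    : Carrier → Fin N
      enum-index : ∀ x → enum (index x) ≈ x

  S : ℕ → ℕ → Carrier → Set (c ⊔ r)
  S q j y = ∃ λ x → ¬ (x ≈ 0#) × (pow x (q ^ j + 1) ≈ y)

  Units : Carrier → Set r
  Units y = ¬ (y ≈ 0#)

  record IsSubgroupOfUnits {p} (P : Carrier → Set p) : Set (c ⊔ r ⊔ p) where
    field
      ⊆units : ∀ x → P x → ¬ (x ≈ 0#)
      has-1  : P 1#
      *-closed : ∀ x y → P x → P y → P (x * y)
      inv-closed : ∀ x → P x → ∃ λ y → P y × (x * y ≈ 1#)

  SameSet : ∀ {p p'} → (Carrier → Set p) → (Carrier → Set p') → Set (c ⊔ p ⊔ p')
  SameSet P Q = ∀ y → (P y → Q y) × (Q y → P y)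

  HasCard : ∀ {p} → (Carrier → Set p) → ℕ → Set (c ⊔ r ⊔ p)
  HasCard P k = Σ (Fin k → Carrier) λ f →
      (∀ i → P (f i))
    × (∀ i j → f i ≈ f j → i ≡ j)
    × (∀ y → P y → ∃ λ i → f i ≈ y)

module Submission where

-- Let n = q^m − 1 = |F^*|. Multiplication by a unit permutes F^*, so x^n = 1 there, and the
-- e-th powers of units lie among the e′-th powers as soon as e′ divides e + i·n for some i.
-- With d = gcd(m, ℓ), Q = q^d and the coprime a = ℓ/d, b = m/d, S_ℓ is the set of
-- (Q^a + 1)-th powers and Q^b = n + 1. If b is odd, Q^a + 1 divides (Q^a)^b + 1 ≡ 2 (mod n).
-- If b is even, a is odd, so Q + 1 divides Q^a + 1; conversely a Bézout relation
-- 1 + ya = xb or 1 + xb = ya, with y necessarily odd, makes Q^a + 1 divide a number ≡ Q + 1.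
-- For g ∣ n there are exactly n/g g-th powers: each is a root of y^(n/g) = 1, and
-- u ↦ (u^g, u/v), v a chosen g-th root of u^g, embeds F^* into the g-th powers times the
-- roots of y^g = 1; a polynomial has at most its degree many roots.

open import Defs
open import Level using (_⊔_)
open import Algebra.Bundles using (CommutativeRing)
import Algebra.Properties.CommutativeSemiring.Exp
open import Data.Nat using (ℕ; zero; suc; _+_; _*_; _∸_; _^_; _/_; _%_; _≤_; z≤n; s≤s; NonZero; ≢-nonZero; ≢-nonZero⁻¹)
open import Data.Nat.Properties
  using (+-comm; +-identityʳ; *-comm; ^-*-assoc; suc-injective; ≤-antisym; ≤-trans; *-cancelʳ-≤; *-monoʳ-≤; m^n≢0)
open import Data.Nat.Divisibility
  using (_∣_; divides; ∣-refl; ∣1⇒≡1; ∣m+n∣m⇒∣n; ∣m∣n⇒∣m+n; ∣m⇒∣m*n; ∣n⇒∣m*n)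
open import Data.Nat.DivMod using (m≡m%n+[m/n]*n; m%n<n; m/n*n≡m)
open import Data.Nat.GCD using (gcd; module Bézout; gcd[m,n]∣m; gcd[m,n]∣n; gcd[m,n]≢0)
open import Data.Nat.Coprimality using (Coprime; coprime-Bézout; coprime-/gcd)
open import Data.Nat.Primality using (prime⇒nonZero)
open import Data.Nat.Tactic.RingSolver using (solve-∀)
open import Data.Fin using (Fin; punchIn; punchOut; combine)
import Data.Fin.Properties as Fin
open import Data.Fin.Permutation using (permutation)
open import Data.List using (List; []; _∷_; length; tabulate; replicate)
open import Data.List.Properties using (length-tabulate; length-replicate)
open import Data.List.Relation.Unary.All using (All; []; _∷_)
import Data.List.Relation.Unary.All.Properties as All
open import Data.List.Relation.Unary.AllPairs using (AllPairs; []; _∷_)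
import Data.List.Relation.Unary.AllPairs.Properties as AllPairs
open import Data.Product using (Σ; ∃; _×_; _,_; proj₁; proj₂)
open import Data.Sum using (inj₁)
open import Function using (_∘_)
open import Relation.Nullary using (¬_; yes; no; contradiction; ¬?)
open import Relation.Nullary.Decidable using (map′; _×-dec_)
open import Relation.Unary using (Pred; _⊆_)
import Relation.Unary as Unary
open import Relation.Binary.Definitions using (_Respects_)
import Relation.Binary.Definitions as Binary
open import Relation.Binary.PropositionalEquality
  using (_≡_; _≢_; refl; sym; trans; cong; subst; subst₂; module ≡-Reasoning)

odd⇒≡1+*2 : ∀ {m} → ¬ 2 ∣ m → ∃ λ t → m ≡ 1 + t * 2
odd⇒≡1+*2 {m} 2∤m with m % 2 | m≡m%n+[m/n]*n m 2 | m%n<n m 2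
... | 0           | m≡[m/2]*2 | _ = contradiction (divides (m / 2) m≡[m/2]*2) 2∤m
... | 1           | m≡1+[m/2]*2 | _ = m / 2 , m≡1+[m/2]*2
... | suc (suc _) | _ | s≤s (s≤s ())

2∣m⇒2∤1+m : ∀ {m} → 2 ∣ m → ¬ 2 ∣ 1 + m
2∣m⇒2∤1+m {m} 2∣m 2∣1+m with () ← ∣1⇒≡1 (∣m+n∣m⇒∣n (subst (2 ∣_) (+-comm 1 m) 2∣1+m) 2∣m)

^-pres-≡1-mod : ∀ {m} e d k → m ≡ 1 + e * d → ∃ λ f → m ^ k ≡ 1 + f * d
^-pres-≡1-mod e d zero    _    = 0 , refl
^-pres-≡1-mod e d (suc k) refl with ^-pres-≡1-mod e d k refl
... | f , eq = e + (1 + e * d) * f , trans (cong ((1 + e * d) *_) eq) (expand e f d)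
  where
  expand : ∀ e f d → (1 + e * d) * (1 + f * d) ≡ 1 + (e + (1 + e * d) * f) * d
  expand = solve-∀

m+1∣m^[1+t*2]+1 : ∀ m t → m + 1 ∣ m ^ (1 + t * 2) + 1
m+1∣m^[1+t*2]+1 m zero    = divides 1 (base m)
  where
  base : ∀ m → m * 1 + 1 ≡ 1 * (m + 1)
  base = solve-∀
m+1∣m^[1+t*2]+1 m (suc t) =
  ∣m+n∣m⇒∣n (subst (m + 1 ∣_) (step m (m ^ (t * 2)))
              (∣m∣n⇒∣m+n (∣n⇒∣m*n (m * m) (m+1∣m^[1+t*2]+1 m t)) ∣-refl))
            (∣n⇒∣m*n m ∣-refl)
  where
  step : ∀ m z → m * m * (m * z + 1) + (m + 1) ≡ m * (m + 1) + (m * (m * (m * z)) + 1)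
  step = solve-∀

m+1∣m^k+1 : ∀ m {k} → ¬ 2 ∣ k → m + 1 ∣ m ^ k + 1
m+1∣m^k+1 m 2∤k with odd⇒≡1+*2 2∤k
... | t , refl = m+1∣m^[1+t*2]+1 m t

m^2≡1+*[1+m] : ∀ m .{{_ : NonZero m}} → ∃ λ k → m ^ 2 ≡ 1 + k * (1 + m)
m^2≡1+*[1+m] (suc k) = k , expand k
  where
  expand : ∀ k → (1 + k) * ((1 + k) * 1) ≡ 1 + k * (1 + (1 + k))
  expand = solve-∀

m^n≡[m^d]^[n/d] : ∀ m {n d} .{{_ : NonZero d}} → d ∣ n → m ^ n ≡ (m ^ d) ^ (n / d)
m^n≡[m^d]^[n/d] m {n} {d} d∣n = begin
  m ^ n             ≡⟨ cong (m ^_) (sym (m/n*n≡m d∣n)) ⟩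
  m ^ (n / d * d)   ≡⟨ cong (m ^_) (*-comm (n / d) d) ⟩
  m ^ (d * (n / d)) ≡⟨ sym (^-*-assoc m d (n / d)) ⟩
  (m ^ d) ^ (n / d) ∎
  where open ≡-Reasoning

odd⇒m^k≡1+*2 : ∀ {m} k → ¬ 2 ∣ m → ∃ λ f → m ^ k ≡ 1 + f * 2
odd⇒m^k≡1+*2 k 2∤m with t , m≡1+2t ← odd⇒≡1+*2 2∤m = ^-pres-≡1-mod t 2 k m≡1+2t

module PowerCongruences (Q a b n : ℕ) (Q^b≡1+n : Q ^ b ≡ suc n) where
  open ≡-Reasoning

  Q^[b*k]≡1+*n : ∀ k → ∃ λ f → Q ^ (b * k) ≡ 1 + f * n
  Q^[b*k]≡1+*n k with ^-pres-≡1-mod 1 n k (trans Q^b≡1+n (cong suc (sym (+-identityʳ n))))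
  ... | f , eq = f , trans (sym (^-*-assoc Q b k)) eq

  odd⇒Q^a+1∣2+*n : ¬ 2 ∣ b → ∃ λ i → Q ^ a + 1 ∣ 2 + i * n
  odd⇒Q^a+1∣2+*n 2∤b with Q^[b*k]≡1+*n a
  ... | f , eq = f , subst (Q ^ a + 1 ∣_) Q^ab+1≡2+fn (m+1∣m^k+1 (Q ^ a) 2∤b)
    where
    Q^ab+1≡2+fn : (Q ^ a) ^ b + 1 ≡ 2 + f * n
    Q^ab+1≡2+fn = begin
      (Q ^ a) ^ b + 1 ≡⟨ cong (_+ 1) (^-*-assoc Q a b) ⟩
      Q ^ (a * b) + 1 ≡⟨ cong (λ e → Q ^ e + 1) (*-comm a b) ⟩
      Q ^ (b * a) + 1 ≡⟨ cong (_+ 1) eq ⟩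
      1 + f * n + 1   ≡⟨ +-comm (1 + f * n) 1 ⟩
      2 + f * n       ∎

  even⇒Q^a+1∣Q+1+*n : Coprime b a → 2 ∣ b → ∃ λ i → Q ^ a + 1 ∣ Q + 1 + i * n
  even⇒Q^a+1∣Q+1+*n coprime 2∣b with coprime-Bézout coprime
  even⇒Q^a+1∣Q+1+*n coprime 2∣b | Bézout.+- x y 1+ya≡xb with Q^[b*k]≡1+*n x
  ... | f , eq = f , subst (Q ^ a + 1 ∣_) Q[Q^ay+1]≡Q+1+fn
                       (∣n⇒∣m*n Q (m+1∣m^k+1 (Q ^ a) 2∤y))
    where
    2∤y : ¬ 2 ∣ y
    2∤y 2∣y = 2∣m⇒2∤1+m (∣m⇒∣m*n a 2∣y) (subst (2 ∣_) (sym 1+ya≡xb) (∣n⇒∣m*n x 2∣b))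
    distrib : ∀ Q P → Q * (P + 1) ≡ Q * P + Q
    distrib = solve-∀
    rearrange : ∀ f n Q → 1 + f * n + Q ≡ Q + 1 + f * n
    rearrange = solve-∀
    Q[Q^ay+1]≡Q+1+fn : Q * ((Q ^ a) ^ y + 1) ≡ Q + 1 + f * n
    Q[Q^ay+1]≡Q+1+fn = begin
      Q * ((Q ^ a) ^ y + 1) ≡⟨ cong (λ e → Q * (e + 1)) (^-*-assoc Q a y) ⟩
      Q * (Q ^ (a * y) + 1) ≡⟨ distrib Q (Q ^ (a * y)) ⟩
      Q ^ (1 + a * y) + Q   ≡⟨ cong (λ e → Q ^ e + Q) (trans (cong suc (*-comm a y)) 1+ya≡xb) ⟩
      Q ^ (x * b) + Q       ≡⟨ cong (λ e → Q ^ e + Q) (*-comm x b) ⟩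
      Q ^ (b * x) + Q       ≡⟨ cong (_+ Q) eq ⟩
      1 + f * n + Q         ≡⟨ rearrange f n Q ⟩
      Q + 1 + f * n         ∎
  even⇒Q^a+1∣Q+1+*n coprime 2∣b | Bézout.-+ x y 1+xb≡ya with Q^[b*k]≡1+*n x
  ... | f , eq = Q * f , subst (Q ^ a + 1 ∣_) Q^ay+1≡Q+1+Qfn (m+1∣m^k+1 (Q ^ a) 2∤y)
    where
    2∤y : ¬ 2 ∣ y
    2∤y 2∣y = 2∣m⇒2∤1+m (∣n⇒∣m*n x 2∣b) (subst (2 ∣_) (sym 1+xb≡ya) (∣m⇒∣m*n a 2∣y))
    expand : ∀ Q f n → Q * (1 + f * n) + 1 ≡ Q + 1 + Q * f * n
    expand = solve-∀
    Q^ay+1≡Q+1+Qfn : (Q ^ a) ^ y + 1 ≡ Q + 1 + Q * f * n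
    Q^ay+1≡Q+1+Qfn = begin
      (Q ^ a) ^ y + 1       ≡⟨ cong (_+ 1) (^-*-assoc Q a y) ⟩
      Q ^ (a * y) + 1       ≡⟨ cong (λ e → Q ^ e + 1) (trans (*-comm a y) (sym 1+xb≡ya)) ⟩
      Q * Q ^ (x * b) + 1   ≡⟨ cong (λ e → Q * Q ^ e + 1) (*-comm x b) ⟩
      Q * Q ^ (b * x) + 1   ≡⟨ cong (λ e → Q * e + 1) eq ⟩
      Q * (1 + f * n) + 1   ≡⟨ expand Q f n ⟩
      Q + 1 + Q * f * n     ∎

  even⇒1+Q∣n : .{{_ : NonZero Q}} → 2 ∣ b → 1 + Q ∣ n
  even⇒1+Q∣n (divides c b≡c*2) with m^2≡1+*[1+m] Q
  ... | k , Q²≡1+k[1+Q] with ^-pres-≡1-mod k (1 + Q) c Q²≡1+k[1+Q]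
  ... | f , eq = divides f (suc-injective (begin
    suc n         ≡⟨ sym Q^b≡1+n ⟩
    Q ^ b         ≡⟨ cong (Q ^_) (trans b≡c*2 (*-comm c 2)) ⟩
    Q ^ (2 * c)   ≡⟨ sym (^-*-assoc Q 2 c) ⟩
    (Q ^ 2) ^ c   ≡⟨ eq ⟩
    1 + f * (1 + Q) ∎))

filterFin : ∀ {p n} {P : Pred (Fin n) p} → Unary.Decidable P →
  Σ ℕ λ k → Σ (Fin k → Fin n) λ g →
    (∀ j → P (g j)) × (∀ j j′ → g j ≡ g j′ → j ≡ j′) × (∀ i → P i → ∃ λ j → g j ≡ i)
filterFin {n = zero} P? = 0 , (λ ()) , (λ ()) , (λ ()) , (λ ())
filterFin {n = suc n} {P} P? with filterFin (P? ∘ Fin.suc) | P? Fin.zero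
... | k , g , g∈P , g-inj , g-onto | no ¬P0 =
  k , Fin.suc ∘ g , g∈P , (λ j j′ → g-inj j j′ ∘ Fin.suc-injective) , onto
  where
  onto : ∀ i → P i → ∃ λ j → Fin.suc (g j) ≡ i
  onto Fin.zero    P0 = contradiction P0 ¬P0
  onto (Fin.suc i) Pi with j , gj≡i ← g-onto i Pi = j , cong Fin.suc gj≡i
... | k , g , g∈P , g-inj , g-onto | yes P0 = suc k , g′ , g′∈P , g′-inj , onto
  where
  g′ : Fin (suc k) → Fin (suc n)
  g′ Fin.zero    = Fin.zero
  g′ (Fin.suc j) = Fin.suc (g j)
  g′∈P : ∀ j → P (g′ j)
  g′∈P Fin.zero    = P0
  g′∈P (Fin.suc j) = g∈P j
  g′-inj : ∀ j j′ → g′ j ≡ g′ j′ → j ≡ j′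
  g′-inj Fin.zero    Fin.zero     _  = refl
  g′-inj (Fin.suc j) (Fin.suc j′) eq = cong Fin.suc (g-inj j j′ (Fin.suc-injective eq))
  onto : ∀ i → P i → ∃ λ j → g′ j ≡ i
  onto Fin.zero    _  = Fin.zero , refl
  onto (Fin.suc i) Pi with j , gj≡i ← g-onto i Pi = Fin.suc j , cong Fin.suc gj≡i

module _ {c r} (R : CommutativeRing c r) where
  open CommutativeRing R using (Carrier; _≈_; reflexive) renaming (sym to ≈-sym; trans to ≈-trans)

  HasCard-resp-SameSet : ∀ {p q k} {P : Pred Carrier p} {Q : Pred Carrier q} →
    SameSet R P Q → HasCard R Q k → HasCard R P k
  HasCard-resp-SameSet P≐Q (f , f∈Q , f-inj , f-onto) =
    f , (λ i → proj₂ (P≐Q (f i)) (f∈Q i)) , f-inj , (λ y → f-onto y ∘ proj₁ (P≐Q y))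

  HasCard-⊆⇒≤ : ∀ {p q a b} {P : Pred Carrier p} {Q : Pred Carrier q} →
    P ⊆ Q → HasCard R P a → HasCard R Q b → a ≤ b
  HasCard-⊆⇒≤ {a = a} {b} P⊆Q (f , f∈P , f-inj , _) (g , _ , _ , g-onto) = Fin.injective⇒≤ h-inj
    where
    h : Fin a → Fin b
    h i = proj₁ (g-onto (f i) (P⊆Q (f∈P i)))
    g∘h≈f : ∀ i → g (h i) ≈ f i
    g∘h≈f i = proj₂ (g-onto (f i) (P⊆Q (f∈P i)))
    h-inj : ∀ {i j} → h i ≡ h j → i ≡ j
    h-inj {i} {j} hi≡hj =
      f-inj i j (≈-trans (≈-sym (g∘h≈f i)) (≈-trans (reflexive (cong g hi≡hj)) (g∘h≈f j)))

module FiniteField {c r} (F : CommutativeRing c r) {n : ℕ} (isFF : IsFiniteFieldOfSize F (suc n)) where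
  open CommutativeRing F
    using (Carrier; _≈_; _≉_; 0#; 1#; -_; setoid; reflexive; commutativeSemiring; *-commutativeMonoid;
           zeroˡ; zeroʳ; -‿inverseˡ)
    renaming (_+_ to _⊕_; _*_ to _·_; *-cong to ·-cong; refl to ≈-refl; sym to ≈-sym; trans to ≈-trans;
              *-congˡ to ·-congˡ; *-congʳ to ·-congʳ; *-assoc to ·-assoc; *-comm to ·-comm;
              *-identityˡ to ·-identityˡ; *-identityʳ to ·-identityʳ;
              +-congˡ to ⊕-congˡ; +-congʳ to ⊕-congʳ; +-identityˡ to ⊕-identityˡ; +-identityʳ to ⊕-identityʳ)
  open IsFiniteFieldOfSize isFF
  open import Relation.Binary.Reasoning.Setoid setoid
  open import Algebra.Solver.Ring.NaturalCoefficients.Default commutativeSemiring using (solve; _:+_; _:*_; _:=_)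
  open import Algebra.Properties.CommutativeMonoid.Sum *-commutativeMonoid
    using (∑-permute; ∑-distrib-+; sum-cong-≋; sum-replicate) renaming (sum to ∏)
  module Exp = Algebra.Properties.CommutativeSemiring.Exp commutativeSemiring

  infixr 8 _^ᶠ_
  _^ᶠ_ : Carrier → ℕ → Carrier
  x ^ᶠ k = pow F x k

  ^ᶠ≡^ : ∀ x k → x ^ᶠ k ≡ x Exp.^ k
  ^ᶠ≡^ x zero    = refl
  ^ᶠ≡^ x (suc k) = cong (x ·_) (^ᶠ≡^ x k)

  ^ᶠ-congˡ : ∀ {x y} k → x ≈ y → x ^ᶠ k ≈ y ^ᶠ k
  ^ᶠ-congˡ {x} {y} k x≈y rewrite ^ᶠ≡^ x k | ^ᶠ≡^ y k = Exp.^-congˡ k x≈y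

  ^ᶠ-homo-· : ∀ x j k → x ^ᶠ (j + k) ≈ x ^ᶠ j · x ^ᶠ k
  ^ᶠ-homo-· x j k rewrite ^ᶠ≡^ x (j + k) | ^ᶠ≡^ x j | ^ᶠ≡^ x k = Exp.^-homo-* x j k

  ^ᶠ-assoc : ∀ x j k → x ^ᶠ (j * k) ≈ (x ^ᶠ j) ^ᶠ k
  ^ᶠ-assoc x j k rewrite ^ᶠ≡^ x (j * k) | ^ᶠ≡^ (x ^ᶠ j) k | ^ᶠ≡^ x j = ≈-sym (Exp.^-assocʳ x j k)

  ^ᶠ-distrib-· : ∀ x y k → (x · y) ^ᶠ k ≈ x ^ᶠ k · y ^ᶠ k
  ^ᶠ-distrib-· x y k rewrite ^ᶠ≡^ (x · y) k | ^ᶠ≡^ x k | ^ᶠ≡^ y k = Exp.^-distrib-* x y k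

  1^ᶠk≈1 : ∀ k → 1# ^ᶠ k ≈ 1#
  1^ᶠk≈1 zero    = ≈-refl
  1^ᶠk≈1 (suc k) = ≈-trans (·-identityˡ _) (1^ᶠk≈1 k)

  index-injective : ∀ {x y} → index x ≡ index y → x ≈ y
  index-injective {x} {y} eq = begin
    x               ≈⟨ enum-index x ⟨
    enum (index x)  ≡⟨ cong enum eq ⟩
    enum (index y)  ≈⟨ enum-index y ⟩
    y               ∎

  index-cong : ∀ {x y} → x ≈ y → index x ≡ index y
  index-cong {x} {y} x≈y = enum-inj _ _ (begin
    enum (index x)  ≈⟨ enum-index x ⟩
    x               ≈⟨ x≈y ⟩
    y               ≈⟨ enum-index y ⟨
    enum (index y)  ∎)

  infix 4 _≈?_
  _≈?_ : Binary.Decidable _≈_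
  x ≈? y = map′ index-injective index-cong (index x Fin.≟ index y)

  _⁻¹ : Carrier → Carrier
  x ⁻¹ with x ≈? 0#
  ... | yes _   = 0#
  ... | no x≉0 = proj₁ (inverse x x≉0)

  ⁻¹-inverseʳ : ∀ {x} → x ≉ 0# → x · x ⁻¹ ≈ 1#
  ⁻¹-inverseʳ {x} x≉0 with x ≈? 0#
  ... | yes x≈0 = contradiction x≈0 x≉0
  ... | no x≉0  = proj₂ (inverse x x≉0)

  ·-cancelʳ : ∀ {x y z} → z ≉ 0# → x · z ≈ y · z → x ≈ y
  ·-cancelʳ {x} {y} {z} z≉0 xz≈yz = begin
    x                ≈⟨ ·-identityʳ x ⟨
    x · 1#           ≈⟨ ·-congˡ (⁻¹-inverseʳ z≉0) ⟨
    x · (z · z ⁻¹)   ≈⟨ ·-assoc x z (z ⁻¹) ⟨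
    (x · z) · z ⁻¹   ≈⟨ ·-congʳ xz≈yz ⟩
    (y · z) · z ⁻¹   ≈⟨ ·-assoc y z (z ⁻¹) ⟩
    y · (z · z ⁻¹)   ≈⟨ ·-congˡ (⁻¹-inverseʳ z≉0) ⟩
    y · 1#           ≈⟨ ·-identityʳ y ⟩
    y                ∎

  ·-cancelʳ-or-≈0 : ∀ {x y z} → x · z ≈ y · z → x ≉ y → z ≈ 0#
  ·-cancelʳ-or-≈0 {z = z} xz≈yz x≉y with z ≈? 0#
  ... | yes z≈0 = z≈0
  ... | no z≉0  = contradiction (·-cancelʳ z≉0 xz≈yz) x≉y

  ·-nonzero : ∀ {x y} → x ≉ 0# → y ≉ 0# → x · y ≉ 0#
  ·-nonzero {x} {y} x≉0 y≉0 xy≈0 =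
    y≉0 (·-cancelʳ-or-≈0 (≈-trans xy≈0 (≈-sym (zeroˡ y))) x≉0)

  ^ᶠ-nonzero : ∀ {x} k → x ≉ 0# → x ^ᶠ k ≉ 0#
  ^ᶠ-nonzero zero    _   = 1≉0
  ^ᶠ-nonzero (suc k) x≉0 = ·-nonzero x≉0 (^ᶠ-nonzero k x≉0)

  ⁻¹-nonzero : ∀ {x} → x ≉ 0# → x ⁻¹ ≉ 0#
  ⁻¹-nonzero {x} x≉0 x⁻¹≈0 = 1≉0 (begin
    1#          ≈⟨ ⁻¹-inverseʳ x≉0 ⟨
    x · x ⁻¹    ≈⟨ ·-congˡ x⁻¹≈0 ⟩
    x · 0#      ≈⟨ zeroʳ x ⟩
    0#          ∎)

  decidable⇒∃HasCard : ∀ {p} {P : Pred Carrier p} → Unary.Decidable P → P Respects _≈_ → ∃ (HasCard F P)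
  decidable⇒∃HasCard {P = P} P? resp with k , g , g∈P , g-inj , g-onto ← filterFin (P? ∘ enum) =
    k , enum ∘ g , g∈P , (λ i j → g-inj i j ∘ enum-inj _ _) , onto
    where
    onto : ∀ y → P y → ∃ λ i → enum (g i) ≈ y
    onto y Py with i , gi≡ ← g-onto (index y) (resp (≈-sym (enum-index y)) Py) =
      i , ≈-trans (reflexive (cong enum gi≡)) (enum-index y)

  unit : Fin n → Carrier
  unit j = enum (punchIn (index 0#) j)

  unit≉0 : ∀ j → unit j ≉ 0#
  unit≉0 j uj≈0 = Fin.punchInᵢ≢i (index 0#) j (enum-inj _ _ (≈-trans uj≈0 (≈-sym (enum-index 0#))))

  unit-injective : ∀ {i j} → unit i ≈ unit j → i ≡ j
  unit-injective = Fin.punchIn-injective (index 0#) _ _ ∘ enum-inj _ _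

  unit-onto : ∀ {y} → y ≉ 0# → ∃ λ j → unit j ≈ y
  unit-onto {y} y≉0 = punchOut 0≢y ,
    ≈-trans (reflexive (cong enum (Fin.punchIn-punchOut 0≢y))) (enum-index y)
    where
    0≢y : index 0# ≢ index y
    0≢y eq = y≉0 (≈-sym (index-injective eq))

  card-units : HasCard F (Units F) n
  card-units = unit , unit≉0 , (λ _ _ → unit-injective) , (λ _ → unit-onto)

  ∏-nonzero : ∀ {k} (t : Fin k → Carrier) → (∀ i → t i ≉ 0#) → ∏ t ≉ 0#
  ∏-nonzero {zero}  t _     = 1≉0
  ∏-nonzero {suc k} t t≉0 = ·-nonzero (t≉0 Fin.zero) (∏-nonzero (t ∘ Fin.suc) (t≉0 ∘ Fin.suc))

  fermat : ∀ {x} → x ≉ 0# → x ^ᶠ n ≈ 1#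
  fermat {x} x≉0 = ·-cancelʳ (∏-nonzero unit unit≉0) (begin
    x ^ᶠ n · ∏ unit            ≈⟨ ·-congʳ (reflexive (^ᶠ≡^ x n)) ⟩
    x Exp.^ n · ∏ unit         ≈⟨ ·-congʳ (sum-replicate n {x}) ⟨
    ∏ {n} (λ _ → x) · ∏ unit   ≈⟨ ∑-distrib-+ (λ _ → x) unit ⟨
    ∏ (λ j → x · unit j)       ≈⟨ sum-cong-≋ (λ j → ≈-sym (unit-scale x≉0 j)) ⟩
    ∏ (unit ∘ scale x≉0)       ≈⟨ ∑-permute unit π ⟨
    ∏ unit                     ≈⟨ ·-identityˡ _ ⟨
    1# · ∏ unit                ∎)
    where
    scale : ∀ {y} → y ≉ 0# → Fin n → Fin n
    scale y≉0 j = proj₁ (unit-onto (·-nonzero y≉0 (unit≉0 j)))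
    unit-scale : ∀ {y} (y≉0 : y ≉ 0#) j → unit (scale y≉0 j) ≈ y · unit j
    unit-scale y≉0 j = proj₂ (unit-onto (·-nonzero y≉0 (unit≉0 j)))
    scale-inverse : ∀ {y z} (y≉0 : y ≉ 0#) (z≉0 : z ≉ 0#) → y · z ≈ 1# → ∀ j → scale y≉0 (scale z≉0 j) ≡ j
    scale-inverse {y} {z} y≉0 z≉0 yz≈1 j = unit-injective (begin
      unit (scale y≉0 (scale z≉0 j)) ≈⟨ unit-scale y≉0 _ ⟩
      y · unit (scale z≉0 j)         ≈⟨ ·-congˡ (unit-scale z≉0 j) ⟩
      y · (z · unit j)               ≈⟨ ·-assoc y z _ ⟨
      (y · z) · unit j               ≈⟨ ·-congʳ yz≈1 ⟩
      1# · unit j                    ≈⟨ ·-identityˡ _ ⟩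
      unit j                         ∎)
    x⁻¹≉0 = ⁻¹-nonzero x≉0
    π = permutation (scale x≉0) (scale x⁻¹≉0)
          (scale-inverse x≉0 x⁻¹≉0 (⁻¹-inverseʳ x≉0))
          (scale-inverse x⁻¹≉0 x≉0 (≈-trans (·-comm _ x) (⁻¹-inverseʳ x≉0)))

  -- monic cs is the monic polynomial of degree length cs whose lower coefficients,
  -- constant term first, are cs.
  monic : List Carrier → Carrier → Carrier
  monic []       x = 1#
  monic (c ∷ cs) x = c ⊕ x · monic cs x

  -- p(x) − p(a) = (x − a) · q(x), with both sides moved so that no subtraction occurs.
  monic-factor : ∀ c cs a → ∃ λ qs → length qs ≡ length cs ×
    (∀ x → monic (c ∷ cs) x ⊕ a · monic qs x ≈ x · monic qs x ⊕ monic (c ∷ cs) a)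
  monic-factor c []        a = [] , refl , λ x →
    solve 4 (λ c x a o → (c :+ x :* o) :+ a :* o := x :* o :+ (c :+ a :* o)) ≈-refl c x a 1#
  monic-factor c (c′ ∷ cs) a with qs , |qs|≡|cs| , factor ← monic-factor c′ cs a =
    monic (c′ ∷ cs) a ∷ qs , cong suc |qs|≡|cs| , λ x → begin
      (c ⊕ x · p′ x) ⊕ a · (p′ a ⊕ x · q x)   ≈⟨ regroup c x (p′ x) a (p′ a) (q x) ⟩
      (c ⊕ a · p′ a) ⊕ x · (p′ x ⊕ a · q x)   ≈⟨ ⊕-congˡ (·-congˡ (factor x)) ⟩
      (c ⊕ a · p′ a) ⊕ x · (x · q x ⊕ p′ a)   ≈⟨ regroup′ c x a (p′ a) (q x) ⟩
      x · (p′ a ⊕ x · q x) ⊕ (c ⊕ a · p′ a)   ∎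
    where
    p′ q : Carrier → Carrier
    p′ = monic (c′ ∷ cs)
    q  = monic qs
    regroup : ∀ c x e a ea q → (c ⊕ x · e) ⊕ a · (ea ⊕ x · q) ≈ (c ⊕ a · ea) ⊕ x · (e ⊕ a · q)
    regroup = solve 6 (λ c x e a ea q →
      (c :+ x :* e) :+ a :* (ea :+ x :* q) := (c :+ a :* ea) :+ x :* (e :+ a :* q)) ≈-refl
    regroup′ : ∀ c x a ea q → (c ⊕ a · ea) ⊕ x · (x · q ⊕ ea) ≈ x · (ea ⊕ x · q) ⊕ (c ⊕ a · ea)
    regroup′ = solve 5 (λ c x a ea q →
      (c :+ a :* ea) :+ x :* (x :* q :+ ea) := x :* (ea :+ x :* q) :+ (c :+ a :* ea)) ≈-refl

  monic-roots-≤ : ∀ cs rs → AllPairs _≉_ rs → All (λ y → monic cs y ≈ 0#) rs → length rs ≤ length cs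
  monic-roots-≤ cs       []       _            _              = z≤n
  monic-roots-≤ []       (a ∷ rs) _            (pa≈0 ∷ _)     = contradiction pa≈0 1≉0
  monic-roots-≤ (c ∷ cs) (a ∷ rs) (a≉rs ∷ rs≉) (pa≈0 ∷ prs≈0)
    with qs , |qs|≡|cs| , factor ← monic-factor c cs a =
    s≤s (subst (length rs ≤_) |qs|≡|cs| (monic-roots-≤ qs rs rs≉ (roots-of-quotient rs a≉rs prs≈0)))
    where
    roots-of-quotient : ∀ bs → All (a ≉_) bs → All (λ y → monic (c ∷ cs) y ≈ 0#) bs →
                        All (λ y → monic qs y ≈ 0#) bs
    roots-of-quotient []       _            _              = []
    roots-of-quotient (b ∷ bs) (a≉b ∷ a≉bs) (pb≈0 ∷ pbs≈0) =
      ·-cancelʳ-or-≈0 aq≈bq a≉b ∷ roots-of-quotient bs a≉bs pbs≈0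
      where
      aq≈bq : a · monic qs b ≈ b · monic qs b
      aq≈bq = begin
        a · monic qs b                         ≈⟨ ⊕-identityˡ _ ⟨
        0# ⊕ a · monic qs b                    ≈⟨ ⊕-congʳ pb≈0 ⟨
        monic (c ∷ cs) b ⊕ a · monic qs b      ≈⟨ factor b ⟩
        b · monic qs b ⊕ monic (c ∷ cs) a      ≈⟨ ⊕-congˡ pa≈0 ⟩
        b · monic qs b ⊕ 0#                    ≈⟨ ⊕-identityʳ _ ⟩
        b · monic qs b                         ∎

  monic-replicate-0# : ∀ k y → monic (replicate k 0#) y ≈ y ^ᶠ k
  monic-replicate-0# zero    y = ≈-refl
  monic-replicate-0# (suc k) y = ≈-trans (⊕-identityˡ _) (·-congˡ (monic-replicate-0# k y))

  card-≤-of-^ᶠ≈1 : ∀ {p} {P : Pred Carrier p} {a} k →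
    HasCard F P a → (∀ {y} → P y → y ^ᶠ suc k ≈ 1#) → a ≤ suc k
  card-≤-of-^ᶠ≈1 k (f , f∈P , f-inj , _) ^ᶠ≈1 =
    subst₂ _≤_ (length-tabulate f) (cong suc (length-replicate k))
      (monic-roots-≤ (- 1# ∷ replicate k 0#) (tabulate f)
        (AllPairs.tabulate⁺ (λ i≢j fi≈fj → i≢j (f-inj _ _ fi≈fj)))
        (All.tabulate⁺ root))
    where
    root : ∀ i → monic (- 1# ∷ replicate k 0#) (f i) ≈ 0#
    root i = begin
      - 1# ⊕ f i · monic (replicate k 0#) (f i)  ≈⟨ ⊕-congˡ (·-congˡ (monic-replicate-0# k (f i))) ⟩
      - 1# ⊕ f i ^ᶠ suc k                        ≈⟨ ⊕-congˡ (^ᶠ≈1 (f∈P i)) ⟩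
      - 1# ⊕ 1#                                  ≈⟨ -‿inverseˡ 1# ⟩
      0#                                         ∎

  Powers : ℕ → Pred Carrier (c ⊔ r)
  Powers e y = ∃ λ x → x ≉ 0# × x ^ᶠ e ≈ y

  Powers-resp-≈ : ∀ e → Powers e Respects _≈_
  Powers-resp-≈ e y≈y′ (x , x≉0 , x^e≈y) = x , x≉0 , ≈-trans x^e≈y y≈y′

  Powers? : ∀ e → Unary.Decidable (Powers e)
  Powers? e y = map′ (λ (i , ok) → enum i , ok) from-element
    (Fin.any? (λ i → ¬? (enum i ≈? 0#) ×-dec (enum i ^ᶠ e ≈? y)))
    where
    from-element : Powers e y → ∃ λ i → enum i ≉ 0# × enum i ^ᶠ e ≈ y
    from-element (x , x≉0 , x^e≈y) = index x ,
      (λ ex≈0 → x≉0 (≈-trans (≈-sym (enum-index x)) ex≈0)) ,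
      ≈-trans (^ᶠ-congˡ e (enum-index x)) x^e≈y

  Powers⊆Units : ∀ {e} → Powers e ⊆ Units F
  Powers⊆Units {e} (x , x≉0 , x^e≈y) y≈0 = ^ᶠ-nonzero e x≉0 (≈-trans x^e≈y y≈0)

  Units⊆Powers-1 : Units F ⊆ Powers 1
  Units⊆Powers-1 {y} y≉0 = y , y≉0 , ·-identityʳ y

  Powers-isSubgroup : ∀ e → IsSubgroupOfUnits F (Powers e)
  Powers-isSubgroup e = record
    { ⊆units     = λ _ → Powers⊆Units {e}
    ; has-1      = 1# , 1≉0 , 1^ᶠk≈1 e
    ; *-closed   = λ _ _ (x , x≉0 , x^e≈y) (x′ , x′≉0 , x′^e≈y′) →
        x · x′ , ·-nonzero x≉0 x′≉0 , ≈-trans (^ᶠ-distrib-· x x′ e) (·-cong x^e≈y x′^e≈y′)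
    ; inv-closed = λ y (x , x≉0 , x^e≈y) →
        (x ⁻¹) ^ᶠ e , (x ⁻¹ , ⁻¹-nonzero x≉0 , ≈-refl) , (begin
          y · (x ⁻¹) ^ᶠ e        ≈⟨ ·-congʳ x^e≈y ⟨
          x ^ᶠ e · (x ⁻¹) ^ᶠ e   ≈⟨ ^ᶠ-distrib-· x (x ⁻¹) e ⟨
          (x · x ⁻¹) ^ᶠ e        ≈⟨ ^ᶠ-congˡ e (⁻¹-inverseʳ x≉0) ⟩
          1# ^ᶠ e                ≈⟨ 1^ᶠk≈1 e ⟩
          1#                     ∎)
    }

  Powers-⊆-∣ : ∀ {e e′} → e′ ∣ e → Powers e ⊆ Powers e′
  Powers-⊆-∣ {e} {e′} (divides w e≡w*e′) {y} (x , x≉0 , x^e≈y) = x ^ᶠ w , ^ᶠ-nonzero w x≉0 , (begin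
    (x ^ᶠ w) ^ᶠ e′   ≈⟨ ^ᶠ-assoc x w e′ ⟨
    x ^ᶠ (w * e′)    ≡⟨ cong (x ^ᶠ_) e≡w*e′ ⟨
    x ^ᶠ e           ≈⟨ x^e≈y ⟩
    y                ∎)

  Powers-⊆-+*n : ∀ {e} i → Powers e ⊆ Powers (e + i * n)
  Powers-⊆-+*n {e} i {y} (x , x≉0 , x^e≈y) = x , x≉0 , (begin
    x ^ᶠ (e + i * n)        ≈⟨ ^ᶠ-homo-· x e (i * n) ⟩
    x ^ᶠ e · x ^ᶠ (i * n)   ≈⟨ ·-congˡ (^ᶠ-assoc x i n) ⟩
    x ^ᶠ e · (x ^ᶠ i) ^ᶠ n  ≈⟨ ·-congˡ (fermat (^ᶠ-nonzero i x≉0)) ⟩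
    x ^ᶠ e · 1#             ≈⟨ ·-identityʳ _ ⟩
    x ^ᶠ e                  ≈⟨ x^e≈y ⟩
    y                       ∎)

  Powers-⊆ : ∀ {e e′} i → e′ ∣ e + i * n → Powers e ⊆ Powers e′
  Powers-⊆ {e} i e′∣e+i*n = Powers-⊆-∣ e′∣e+i*n ∘ Powers-⊆-+*n {e} i

  RootsOfUnity : ℕ → Pred Carrier r
  RootsOfUnity e y = y ^ᶠ e ≈ 1#

  RootsOfUnity? : ∀ e → Unary.Decidable (RootsOfUnity e)
  RootsOfUnity? e y = y ^ᶠ e ≈? 1#

  RootsOfUnity-resp-≈ : ∀ e → RootsOfUnity e Respects _≈_
  RootsOfUnity-resp-≈ e x≈y x^e≈1 = ≈-trans (^ᶠ-congˡ e (≈-sym x≈y)) x^e≈1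

  ·⁻¹-RootOfUnity : ∀ e {x y} → y ≉ 0# → x ^ᶠ e ≈ y ^ᶠ e → RootsOfUnity e (x · y ⁻¹)
  ·⁻¹-RootOfUnity e {x} {y} y≉0 x^e≈y^e = begin
    (x · y ⁻¹) ^ᶠ e          ≈⟨ ^ᶠ-distrib-· x (y ⁻¹) e ⟩
    x ^ᶠ e · (y ⁻¹) ^ᶠ e     ≈⟨ ·-congʳ x^e≈y^e ⟩
    y ^ᶠ e · (y ⁻¹) ^ᶠ e     ≈⟨ ^ᶠ-distrib-· y (y ⁻¹) e ⟨
    (y · y ⁻¹) ^ᶠ e          ≈⟨ ^ᶠ-congˡ e (⁻¹-inverseʳ y≉0) ⟩
    1# ^ᶠ e                  ≈⟨ 1^ᶠk≈1 e ⟩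
    1#                       ∎

  card-Powers-≤ : ∀ g {k c} → n ≡ k * g → HasCard F (Powers g) c → c ≤ k
  card-Powers-≤ g {zero} n≡0 Pc = HasCard-⊆⇒≤ F (Powers⊆Units {g}) Pc (subst (HasCard F (Units F)) n≡0 card-units)
  card-Powers-≤ g {suc k} n≡k*g Pc = card-≤-of-^ᶠ≈1 k Pc λ {y} (x , x≉0 , x^g≈y) → begin
    y ^ᶠ suc k            ≈⟨ ^ᶠ-congˡ (suc k) x^g≈y ⟨
    (x ^ᶠ g) ^ᶠ suc k     ≈⟨ ^ᶠ-assoc x g (suc k) ⟨
    x ^ᶠ (g * suc k)      ≡⟨ cong (x ^ᶠ_) (trans (*-comm g (suc k)) (sym n≡k*g)) ⟩
    x ^ᶠ n                ≈⟨ fermat x≉0 ⟩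
    1#                    ∎

  units-≤-Powers*Roots : ∀ g {c κ} → HasCard F (Powers g) c → HasCard F (RootsOfUnity g) κ → n ≤ c * κ
  units-≤-Powers*Roots g {c} {κ} (p , p∈Powers , _ , p-onto) (ρ , _ , _ , ρ-onto) = Fin.injective⇒≤ φ-inj
    where
    root : Fin c → Carrier
    root i = proj₁ (p∈Powers i)
    root≉0 : ∀ i → root i ≉ 0#
    root≉0 i = proj₁ (proj₂ (p∈Powers i))
    powerIndex : Fin n → Fin c
    powerIndex j = proj₁ (p-onto (unit j ^ᶠ g) (unit j , unit≉0 j , ≈-refl))
    quotient : Fin n → Carrier
    quotient j = unit j · root (powerIndex j) ⁻¹
    quotient-root : ∀ j → RootsOfUnity g (quotient j)
    quotient-root j = ·⁻¹-RootOfUnity g (root≉0 i) (begin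
      unit j ^ᶠ g   ≈⟨ proj₂ (p-onto (unit j ^ᶠ g) (unit j , unit≉0 j , ≈-refl)) ⟨
      p i           ≈⟨ proj₂ (proj₂ (p∈Powers i)) ⟨
      root i ^ᶠ g   ∎)
      where i = powerIndex j
    quotientIndex : Fin n → Fin κ
    quotientIndex j = proj₁ (ρ-onto (quotient j) (quotient-root j))
    ρ-quotientIndex : ∀ j → ρ (quotientIndex j) ≈ quotient j
    ρ-quotientIndex j = proj₂ (ρ-onto (quotient j) (quotient-root j))
    φ : Fin n → Fin (c * κ)
    φ j = combine (powerIndex j) (quotientIndex j)
    φ-inj : ∀ {i j} → φ i ≡ φ j → i ≡ j
    φ-inj {i} {j} φi≡φj = unit-injective (·-cancelʳ (⁻¹-nonzero (root≉0 (powerIndex i))) (begin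
      quotient i                           ≈⟨ ρ-quotientIndex i ⟨
      ρ (quotientIndex i)                  ≡⟨ cong ρ (proj₂ same) ⟩
      ρ (quotientIndex j)                  ≈⟨ ρ-quotientIndex j ⟩
      quotient j                           ≡⟨ cong (λ k → unit j · root k ⁻¹) (proj₁ same) ⟨
      unit j · root (powerIndex i) ⁻¹      ∎))
      where
      same = Fin.combine-injective (powerIndex i) (quotientIndex i) (powerIndex j) (quotientIndex j) φi≡φj

  card-Powers : ∀ g k → n ≡ k * suc g → HasCard F (Powers (suc g)) k
  card-Powers g k n≡k*g
    with c , Pc ← decidable⇒∃HasCard (Powers? (suc g)) (Powers-resp-≈ (suc g))
    with κ , Rκ ← decidable⇒∃HasCard (RootsOfUnity? (suc g)) (RootsOfUnity-resp-≈ (suc g))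
    = subst (HasCard F (Powers (suc g))) (≤-antisym (card-Powers-≤ (suc g) n≡k*g Pc) k≤c) Pc
    where
    k≤c : k ≤ c
    k≤c = *-cancelʳ-≤ k c (suc g) (subst (_≤ c * suc g) n≡k*g
      (≤-trans (units-≤-Powers*Roots (suc g) Pc Rκ) (*-monoʳ-≤ c (card-≤-of-^ᶠ≈1 g Rκ (λ y^g≈1 → y^g≈1)))))

primePower≢0 : ∀ {q} → IsPrimePower q → NonZero q
primePower≢0 (p , k , p-prime , q≡p^[1+k]) =
  subst NonZero (sym q≡p^[1+k]) (m^n≢0 p (suc k) {{prime⇒nonZero p-prime}})

module PowerSubgroups (q m′ ℓ n : ℕ) .{{_ : NonZero q}} (q^m≡1+n : q ^ suc m′ ≡ suc n)
                      {c r} (F : CommutativeRing c r) (isFF : IsFiniteFieldOfSize F (suc n)) where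
  open FiniteField F isFF

  private
    m d : ℕ
    m = suc m′
    d = gcd m ℓ

    instance
      d≢0 : NonZero d
      d≢0 = ≢-nonZero (gcd[m,n]≢0 m ℓ (inj₁ λ ()))

    q^ℓ≡[q^d]^[ℓ/d] : q ^ ℓ ≡ (q ^ d) ^ (ℓ / d)
    q^ℓ≡[q^d]^[ℓ/d] = m^n≡[m^d]^[n/d] q (gcd[m,n]∣n m ℓ)

    2∣1+1*n : 2 ∣ q → 2 ∣ 1 + 1 * n
    2∣1+1*n 2∣q = subst (2 ∣_) (trans q^m≡1+n (cong suc (sym (+-identityʳ n)))) (∣m⇒∣m*n (q ^ m′) 2∣q)

  open PowerCongruences (q ^ d) (ℓ / d) (m / d) n
    (trans (sym (m^n≡[m^d]^[n/d] q (gcd[m,n]∣m m ℓ))) q^m≡1+n)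

  squares⊆S : ¬ 2 ∣ mSub m ℓ → Powers 2 ⊆ S F q ℓ
  squares⊆S 2∤mℓ with i , ∣2+i*n ← odd⇒Q^a+1∣2+*n 2∤mℓ =
    Powers-⊆ i (subst (λ e → e + 1 ∣ 2 + i * n) (sym q^ℓ≡[q^d]^[ℓ/d]) ∣2+i*n)

  S≐units : 2 ∣ q → ¬ 2 ∣ mSub m ℓ → SameSet F (S F q ℓ) (Units F)
  S≐units 2∣q 2∤mℓ _ =
    Powers⊆Units {q ^ ℓ + 1} , squares⊆S 2∤mℓ ∘ Powers-⊆ {1} 1 (2∣1+1*n 2∣q) ∘ Units⊆Powers-1

  S≐squares : ¬ 2 ∣ q → ¬ 2 ∣ mSub m ℓ → SameSet F (S F q ℓ) (S F q 0)
  S≐squares 2∤q 2∤mℓ _ with f , q^ℓ≡1+2f ← odd⇒m^k≡1+*2 ℓ 2∤q =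
    Powers-⊆-∣ (divides (suc f) (trans (cong (_+ 1) q^ℓ≡1+2f) (+-comm (1 + f * 2) 1))) , squares⊆S 2∤mℓ

  S≐S-gcd : 2 ∣ mSub m ℓ → SameSet F (S F q ℓ) (S F q d)
  S≐S-gcd 2∣mℓ _ with i , ∣q^d+1+i*n ← even⇒Q^a+1∣Q+1+*n (coprime-/gcd m ℓ) 2∣mℓ =
    Powers-⊆-∣ (subst (λ e → q ^ d + 1 ∣ e + 1) (sym q^ℓ≡[q^d]^[ℓ/d]) (m+1∣m^k+1 (q ^ d) 2∤ℓ/d)) ,
    Powers-⊆ i (subst (λ e → e + 1 ∣ q ^ d + 1 + i * n) (sym q^ℓ≡[q^d]^[ℓ/d]) ∣q^d+1+i*n)
    where
    2∤ℓ/d : ¬ 2 ∣ ℓ / d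
    2∤ℓ/d 2∣ℓ/d with () ← coprime-/gcd m ℓ (2∣mℓ , 2∣ℓ/d)

  card-squares : ¬ 2 ∣ q → HasCard F (S F q 0) (n / 2)
  card-squares 2∤q with f , q^m≡1+2f ← odd⇒m^k≡1+*2 m 2∤q =
    card-Powers 1 (n / 2) (sym (m/n*n≡m (divides f (suc-injective (trans (sym q^m≡1+n) q^m≡1+2f)))))

  card-S-gcd : 2 ∣ mSub m ℓ → HasCard F (S F q d) (n / (1 + q ^ d))
  card-S-gcd 2∣mℓ = subst (λ e → HasCard F (Powers e) (n / (1 + q ^ d))) (+-comm 1 (q ^ d))
    (card-Powers (q ^ d) _ (sym (m/n*n≡m (even⇒1+Q∣n {{m^n≢0 q d}} 2∣mℓ))))

lemma2p3 : ∀ {c r} (q m ℓ : ℕ) → IsPrimePower q → 1 ≤ m →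
    (F : CommutativeRing c r) → IsFiniteFieldOfSize F (q ^ m) →
      IsSubgroupOfUnits F (S F q ℓ)
      × (2 ∣ q → (¬ (2 ∣ mSub m ℓ) → SameSet F (S F q ℓ) (Units F))
               × (2 ∣ mSub m ℓ → SameSet F (S F q ℓ) (S F q (gcd m ℓ))))
      × (¬ (2 ∣ q) → (¬ (2 ∣ mSub m ℓ) → SameSet F (S F q ℓ) (S F q 0))
                   × (2 ∣ mSub m ℓ → SameSet F (S F q ℓ) (S F q (gcd m ℓ))))
      × (¬ (2 ∣ mSub m ℓ) →
           (2 ∣ q → HasCard F (S F q ℓ) (q ^ m ∸ 1))
         × (¬ (2 ∣ q) → HasCard F (S F q ℓ) ((q ^ m ∸ 1) / 2)
                      × HasCard F (S F q 0) ((q ^ m ∸ 1) / 2)))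
      × (2 ∣ mSub m ℓ →
           HasCard F (S F q ℓ) ((q ^ m ∸ 1) / (1 + q ^ gcd m ℓ))
         × HasCard F (S F q (gcd m ℓ)) ((q ^ m ∸ 1) / (1 + q ^ gcd m ℓ)))
lemma2p3 q (suc m′) ℓ q-primePower (s≤s z≤n) F isFF with q ^ suc m′ in q^m≡
... | zero  = contradiction q^m≡ (≢-nonZero⁻¹ _ {{m^n≢0 q (suc m′) {{primePower≢0 q-primePower}}}})
... | suc n =
  Powers-isSubgroup (q ^ ℓ + 1) ,
  (λ 2∣q → S≐units 2∣q , S≐S-gcd) ,
  (λ 2∤q → S≐squares 2∤q , S≐S-gcd) ,
  (λ 2∤mℓ → (λ 2∣q → HasCard-resp-SameSet F (S≐units 2∣q 2∤mℓ) card-units) ,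
            (λ 2∤q → HasCard-resp-SameSet F (S≐squares 2∤q 2∤mℓ) (card-squares 2∤q) , card-squares 2∤q)) ,
  (λ 2∣mℓ → HasCard-resp-SameSet F (S≐S-gcd 2∣mℓ) (card-S-gcd 2∣mℓ) , card-S-gcd 2∣mℓ)
  where
  open FiniteField F isFF
  open PowerSubgroups q m′ ℓ n {{primePower≢0 q-primePower}} q^m≡ F isFF
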